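{- Let $X,Y$ be binary strings and $\ell\ge1$. With $\mathcal{F}$, $N_0$, $N_1$ as in the context, if $\mathrm{LCF}_1(X,Y)\ge\ell$ then $$\mathrm{LCF}_1(X,Y)=\max_{k_1+k_2=1}\mathrm{maxPairLCP}\big(\mathrm{Pairs}^{(k_1)}_\ell(X),\mathrm{Pairs}^{(k_2)}_\ell(Y)\big),$$ where $k_1,k_2\in\{0,1\}$.
   Context: Strings are indexed from 1; $U^R$ is the reversal, $U[..i]=U[1..i]$, $U[i..]=U[i..|U|]$; $d_H$ is Hamming distance; $\mathrm{LCP}(U,V)$ is the longest common prefix length. $\mathrm{LCF}_k(X,Y)$ is the maximum $m$ such that some length-$m$ factors of $X$ and $Y$ have Hamming distance at most $k$. A set $S(d)\subseteq\mathbb{Z}_+$ is a $d$-cover if there is a function $h$ with $0\le h(i,j)<d$ and $i+h(i,j),j+h(i,j)\in S(d)$ for all $i,j\in\mathbb{Z}_+$; a fixed $\ell$-cover $S(\ell)$ is used and $\mathrm{Pairs}_\ell(U)=\{((U[..i-1])^R,U[i..]) : i\in S(\ell)\cap[1..|U|]\}$. $\mathcal{F}$ is the family of all strings occurring as a component of a pair in $\mathrm{Pairs}_\ell(X)\cup\mathrm{Pairs}_\ell(Y)$. In the compacted trie $\mathcal{T}(\mathcal{F})$ (root, branching and terminal nodes of the trie of $\mathcal{F}$) some edges are marked light so that each node has at most one outgoing non-light edge and each root-to-leaf path has $\mathcal{O}(\log|\mathcal{T}(\mathcal{F})|)$ light edges. For $F\in\mathcal{F}$, $N_1(F)$ consists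 of $F$ and every string obtained from $F$ by flipping the letter at the position corresponding to the first letter of a single light edge on the path representing $F$; $N_0(F)=\{F\}$. For $S\in\{X,Y\}$ and $d\in\{0,1\}$, $\mathrm{Pairs}^{(d)}_\ell(S)=\bigcup_{(U_1,U_2)\in\mathrm{Pairs}_\ell(S),\ d_1+d_2=d}\{(U_1',U_2') : U_1'\in N_{d_1}(U_1),\ U_2'\in N_{d_2}(U_2)\}$ with $d_1,d_2\in\{0,1\}$. For sets $\mathcal{P},\mathcal{Q}$ of pairs of strings, $\mathrm{maxPairLCP}(\mathcal{P},\mathcal{Q})=\max\{\mathrm{LCP}(P_1,Q_1)+\mathrm{LCP}(P_2,Q_2) : (P_1,P_2)\in\mathcal{P},(Q_1,Q_2)\in\mathcal{Q}\}$. -}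

module Defs where

open import Data.Bool using (Bool; true; false; not)
open import Data.Nat using (ℕ; zero; suc; _+_; _∸_; _≤_; _<_)
open import Data.List using (List; []; _∷_; _++_; length; take; drop; reverse; [_])
open import Data.Product using (_×_; _,_; Σ; ∃; ∃-syntax)
open import Data.Sum using (_⊎_)
open import Data.Empty using (⊥)
open import Relation.Binary.PropositionalEquality using (_≡_)
open import Relation.Nullary using (¬_)

-- Binary strings (1-indexed in the paper; lists here).
Str : Set
Str = List Bool

StrPair : Set
StrPair = Str × Str

-- Hamming distance (used only on equal-length strings).
dH : Str → Str → ℕ
dH [] _ = 0
dH (_ ∷ _) [] = 0
dH (true ∷ u) (true ∷ v) = dH u v
dH (false ∷ u) (false ∷ v) = dH u v
dH (true ∷ u) (false ∷ v) = suc (dH u v)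
dH (false ∷ u) (true ∷ v) = suc (dH u v)

LCP : Str → Str → ℕ
LCP [] _ = 0
LCP (_ ∷ _) [] = 0
LCP (true ∷ u) (true ∷ v) = suc (LCP u v)
LCP (false ∷ u) (false ∷ v) = suc (LCP u v)
LCP (true ∷ u) (false ∷ v) = 0
LCP (false ∷ u) (true ∷ v) = 0

IsMax : (ℕ → Set) → ℕ → Set
IsMax A m = A m × (∀ n → A n → n ≤ m)

-- W is a length-m factor of S (starting at 0-based offset i, i.e. S[i+1..i+m]).
IsFactor : ℕ → Str → Str → Set
IsFactor m S W = ∃[ i ] (i + m ≤ length S × W ≡ take m (drop i S))

LCFSet : ℕ → Str → Str → ℕ → Set
LCFSet k X Y m = ∃[ U ] ∃[ V ] (IsFactor m X U × IsFactor m Y V × dH U V ≤ k)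

IsLCF : ℕ → Str → Str → ℕ → Set
IsLCF k X Y m = IsMax (LCFSet k X Y) m

-- S ⊆ ℤ+ (given as a predicate on ℕ) is a d-cover.
IsCover : ℕ → (ℕ → Set) → Set
IsCover d S = (¬ S 0) ×
  (Σ (ℕ → ℕ → ℕ) λ h → (∀ i j → 1 ≤ i → 1 ≤ j → h i j < d × S (i + h i j) × S (j + h i j)))

Pairs : (ℕ → Set) → Str → StrPair → Set
Pairs S U P = ∃[ i ] (S i × 1 ≤ i × i ≤ length U ×
  P ≡ (reverse (take (i ∸ 1) U) , drop (i ∸ 1) U))

InFam : (ℕ → Set) → Str → Str → Str → Set
InFam S X Y F = ∃[ P ] ((Pairs S X P ⊎ Pairs S Y P) ×
  (F ≡ Data.Product.proj₁ P ⊎ F ≡ Data.Product.proj₂ P))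

IsPrefix : Str → Str → Set
IsPrefix p s = ∃[ t ] (p ++ t ≡ s)

-- u·c is a prefix of some string of the family (u has an outgoing trie edge labelled c first).
HasChild : (Str → Set) → Str → Bool → Set
HasChild Fam u c = ∃[ F ] (Fam F × IsPrefix (u ++ [ c ]) F)

-- Nodes of the compacted trie 𝓣(𝓕): root, branching nodes, terminal nodes.
-- A node is identified with the string it represents.
IsNode : (Str → Set) → Str → Set
IsNode Fam u = u ≡ [] ⊎ (HasChild Fam u false × HasChild Fam u true) ⊎ Fam u

-- Edges of 𝓣(𝓕) are identified by (u , c): u a node, c the first letter
-- of the edge (u·c a prefix of a string of 𝓕).  A light-edge marking
-- Light u c; validity: each node has at most one outgoing non-light edge.
ValidLight : (Str → Set) → (Str → Bool → Set) → Set
ValidLight Fam Light = ∀ u → IsNode Fam u →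
  HasChild Fam u false → HasChild Fam u true → Light u false ⊎ Light u true

N1 : (Str → Set) → (Str → Bool → Set) → Str → Str → Set
N1 Fam Light F G = G ≡ F ⊎
  (∃[ u ] ∃[ c ] (IsNode Fam u × IsPrefix (u ++ [ c ]) F × Light u c ×
     G ≡ u ++ (not c ∷ drop (suc (length u)) F)))

-- N_d for d ∈ {0,1}; empty for d ≥ 2 (never used).
Nd : ℕ → (Str → Set) → (Str → Bool → Set) → Str → Str → Set
Nd zero Fam Light F G = G ≡ F
Nd (suc zero) Fam Light F G = N1 Fam Light F G
Nd (suc (suc _)) Fam Light F G = ⊥

PairsD : ℕ → (ℕ → Set) → (Str → Set) → (Str → Bool → Set) → Str → StrPair → Set
PairsD d S Fam Light U P' = ∃[ P ] ∃[ d₁ ] ∃[ d₂ ] (Pairs S U P × d₁ ≤ 1 × d₂ ≤ 1 ×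
  d₁ + d₂ ≡ d × Nd d₁ Fam Light (Data.Product.proj₁ P) (Data.Product.proj₁ P') ×
  Nd d₂ Fam Light (Data.Product.proj₂ P) (Data.Product.proj₂ P'))

PairLCPVal : (StrPair → Set) → (StrPair → Set) → ℕ → Set
PairLCPVal 𝓟 𝓠 n = ∃[ P ] ∃[ Q ] (𝓟 P × 𝓠 Q ×
  n ≡ LCP (Data.Product.proj₁ P) (Data.Product.proj₁ Q) + LCP (Data.Product.proj₂ P) (Data.Product.proj₂ Q))

IsMaxPairLCP : (StrPair → Set) → (StrPair → Set) → ℕ → Set
IsMaxPairLCP 𝓟 𝓠 m = IsMax (PairLCPVal 𝓟 𝓠) m

module Submission where

-- Corollary 7: if LCF₁(X,Y) = m ≥ ℓ, then m is the largest value
-- maxPairLCP(Pairs^(k₁)_ℓ(X), Pairs^(k₂)_ℓ(Y)) over k₁ + k₂ = 1.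
-- A pair (P₁,P₂) = ((U[..k])^R, U[k+1..]) is a cut of U; its (a,b)-window
-- (P₁[..a])^R · P₂[..b] is the length-(a+b) factor of U straddling the cut.
-- Soundness: a pair value LCP(P₁′,Q₁′) + LCP(P₂′,Q₂′) of neighbours of cuts P, Q
-- is the length of the windows of P and Q of those widths; they differ in at most
-- k₁ + k₂ = 1 positions because P′, Q′ are within that Hamming budget of P, Q.
-- Hence every value is at most m.
-- Completeness: take factors X[x+1..x+m], Y[y+1..y+m] at distance ≤ 1 and use
-- the cover to cut both at a common offset h < ℓ ≤ m.  The mismatch, if any,
-- lies in one half; there the two family strings first differ at a branching
-- node of the trie, one of whose edges is light, and flipping that letter on the
-- corresponding side puts the repaired half into N₁ and makes the halves agree.

open import Defs
open import Data.Bool using (Bool; true; false; not)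
open import Data.Bool.Properties using (not-involutive)
open import Data.Nat using (ℕ; zero; suc; _+_; _∸_; _⊓_; _≤_; _<_; z≤n; s≤s)
open import Data.Nat.Properties
open import Data.List using ([]; _∷_; _++_; length; take; drop; reverse; [_])
open import Data.List.Properties
  using (take++drop≡id; length-take; length-drop; length-++; length-reverse; reverse-++; reverse-involutive; unfold-reverse; ++-assoc)
open import Data.Product using (_×_; _,_; ∃-syntax; proj₁; proj₂)
open import Data.Sum using (_⊎_; inj₁; inj₂; swap)
open import Relation.Binary.PropositionalEquality hiding ([_])
open import Algebra.Properties.CommutativeSemigroup +-commutativeSemigroup using (interchange)

parts≤ : ∀ a b {c} → a + b ≤ c → a ≤ c × b ≤ c
parts≤ a b le = ≤-trans (m≤m+n a b) le , ≤-trans (m≤n+m b a) le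

split-≤1 : ∀ s t → s + t ≤ 1 → (s ≡ 0 × t ≤ 1) ⊎ (s ≤ 1 × t ≡ 0)
split-≤1 zero    t le       = inj₁ (refl , le)
split-≤1 (suc s) t (s≤s le) =
  inj₂ (s≤s (proj₁ (parts≤ s t le)) , n≤0⇒n≡0 (proj₂ (parts≤ s t le)))

dH-∷ : ∀ a b u v → dH (a ∷ u) (b ∷ v) ≡ dH [ a ] [ b ] + dH u v
dH-∷ true  true  u v = refl
dH-∷ true  false u v = refl
dH-∷ false true  u v = refl
dH-∷ false false u v = refl

dH-refl : ∀ u → dH u u ≡ 0
dH-refl []          = refl
dH-refl (true ∷ u)  = dH-refl u
dH-refl (false ∷ u) = dH-refl u

dH-sym : ∀ u v → dH u v ≡ dH v u
dH-sym []          []          = refl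
dH-sym []          (_ ∷ _)     = refl
dH-sym (_ ∷ _)     []          = refl
dH-sym (true ∷ u)  (true ∷ v)  = dH-sym u v
dH-sym (true ∷ u)  (false ∷ v) = cong suc (dH-sym u v)
dH-sym (false ∷ u) (true ∷ v)  = cong suc (dH-sym u v)
dH-sym (false ∷ u) (false ∷ v) = dH-sym u v

letter-tri : ∀ a b c → dH [ a ] [ c ] ≤ dH [ a ] [ b ] + dH [ b ] [ c ]
letter-tri true  _     true  = z≤n
letter-tri false _     false = z≤n
letter-tri true  true  false = s≤s z≤n
letter-tri true  false false = s≤s z≤n
letter-tri false true  true  = s≤s z≤n
letter-tri false false true  = s≤s z≤n

-- The triangle inequality (the middle string must be long enough to compare).
dH-tri : ∀ u v w → length u ≤ length v → dH u w ≤ dH u v + dH v w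
dH-tri []      _       _       _        = z≤n
dH-tri (_ ∷ _) []      _       ()
dH-tri (_ ∷ _) (_ ∷ _) []      _        = z≤n
dH-tri (a ∷ u) (b ∷ v) (c ∷ w) (s≤s le) = begin
  dH (a ∷ u) (c ∷ w)                                     ≡⟨ dH-∷ a c u w ⟩
  dH [ a ] [ c ] + dH u w                                ≤⟨ +-mono-≤ (letter-tri a b c) (dH-tri u v w le) ⟩
  (dH [ a ] [ b ] + dH [ b ] [ c ]) + (dH u v + dH v w) ≡⟨ interchange (dH [ a ] [ b ]) (dH [ b ] [ c ]) (dH u v) (dH v w) ⟩
  (dH [ a ] [ b ] + dH u v) + (dH [ b ] [ c ] + dH v w) ≡⟨ sym (cong₂ _+_ (dH-∷ a b u v) (dH-∷ b c v w)) ⟩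
  dH (a ∷ u) (b ∷ v) + dH (b ∷ v) (c ∷ w)                ∎
  where open ≤-Reasoning

dH-take : ∀ n u v → dH (take n u) (take n v) ≤ dH u v
dH-take zero    _       _       = z≤n
dH-take (suc n) []      _       = z≤n
dH-take (suc n) (_ ∷ _) []      = z≤n
dH-take (suc n) (a ∷ u) (b ∷ v) =
  subst₂ _≤_ (sym (dH-∷ a b (take n u) (take n v))) (sym (dH-∷ a b u v))
    (+-monoʳ-≤ (dH [ a ] [ b ]) (dH-take n u v))

dH-++ : ∀ u u′ v v′ → length u ≡ length u′ → dH (u ++ v) (u′ ++ v′) ≡ dH u u′ + dH v v′
dH-++ []      []       v v′ _ = refl
dH-++ (a ∷ u) (b ∷ u′) v v′ e = begin
  dH (a ∷ u ++ v) (b ∷ u′ ++ v′)        ≡⟨ dH-∷ a b _ _ ⟩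
  dH [ a ] [ b ] + dH (u ++ v) (u′ ++ v′) ≡⟨ cong (dH [ a ] [ b ] +_) (dH-++ u u′ v v′ (suc-injective e)) ⟩
  dH [ a ] [ b ] + (dH u u′ + dH v v′)   ≡⟨ sym (+-assoc (dH [ a ] [ b ]) _ _) ⟩
  dH [ a ] [ b ] + dH u u′ + dH v v′     ≡⟨ cong (_+ dH v v′) (sym (dH-∷ a b u u′)) ⟩
  dH (a ∷ u) (b ∷ u′) + dH v v′          ∎
  where open ≡-Reasoning

dH-reverse : ∀ u v → length u ≡ length v → dH (reverse u) (reverse v) ≡ dH u v
dH-reverse []      []      _ = refl
dH-reverse (a ∷ u) (b ∷ v) e = begin
  dH (reverse (a ∷ u)) (reverse (b ∷ v))        ≡⟨ cong₂ dH (unfold-reverse a u) (unfold-reverse b v) ⟩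
  dH (reverse u ++ [ a ]) (reverse v ++ [ b ])  ≡⟨ dH-++ (reverse u) (reverse v) [ a ] [ b ] reversed-lengths ⟩
  dH (reverse u) (reverse v) + dH [ a ] [ b ]   ≡⟨ cong (_+ dH [ a ] [ b ]) (dH-reverse u v (suc-injective e)) ⟩
  dH u v + dH [ a ] [ b ]                       ≡⟨ +-comm (dH u v) _ ⟩
  dH [ a ] [ b ] + dH u v                       ≡⟨ sym (dH-∷ a b u v) ⟩
  dH (a ∷ u) (b ∷ v)                            ∎
  where
  open ≡-Reasoning
  reversed-lengths : length (reverse u) ≡ length (reverse v)
  reversed-lengths = trans (length-reverse u) (trans (suc-injective e) (sym (length-reverse v)))

LCP-∷ : ∀ c A B → LCP (c ∷ A) (c ∷ B) ≡ suc (LCP A B)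
LCP-∷ true  A B = refl
LCP-∷ false A B = refl

LCP-++ : ∀ w A B → LCP (w ++ A) (w ++ B) ≡ length w + LCP A B
LCP-++ []      A B = refl
LCP-++ (c ∷ w) A B = trans (LCP-∷ c (w ++ A) (w ++ B)) (cong suc (LCP-++ w A B))

LCP-after : ∀ w c A B → LCP (w ++ c ∷ A) (w ++ c ∷ B) ≡ length w + suc (LCP A B)
LCP-after w c A B = trans (LCP-++ w (c ∷ A) (c ∷ B)) (cong (length w +_) (LCP-∷ c A B))

LCP-take : ∀ u v → take (LCP u v) u ≡ take (LCP u v) v
LCP-take []          _           = refl
LCP-take (_ ∷ _)     []          = refl
LCP-take (true ∷ u)  (true ∷ v)  = cong (true ∷_) (LCP-take u v)
LCP-take (false ∷ u) (false ∷ v) = cong (false ∷_) (LCP-take u v)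
LCP-take (true ∷ u)  (false ∷ v) = refl
LCP-take (false ∷ u) (true ∷ v)  = refl

LCP-lenˡ : ∀ u v → LCP u v ≤ length u
LCP-lenˡ []          _           = z≤n
LCP-lenˡ (_ ∷ _)     []          = z≤n
LCP-lenˡ (true ∷ u)  (true ∷ v)  = s≤s (LCP-lenˡ u v)
LCP-lenˡ (false ∷ u) (false ∷ v) = s≤s (LCP-lenˡ u v)
LCP-lenˡ (true ∷ u)  (false ∷ v) = z≤n
LCP-lenˡ (false ∷ u) (true ∷ v)  = z≤n

LCP-lenʳ : ∀ u v → LCP u v ≤ length v
LCP-lenʳ []          _           = z≤n
LCP-lenʳ (_ ∷ _)     []          = z≤n
LCP-lenʳ (true ∷ u)  (true ∷ v)  = s≤s (LCP-lenʳ u v)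
LCP-lenʳ (false ∷ u) (false ∷ v) = s≤s (LCP-lenʳ u v)
LCP-lenʳ (true ∷ u)  (false ∷ v) = z≤n
LCP-lenʳ (false ∷ u) (true ∷ v)  = z≤n

noMismatch : ∀ n A B → n ≤ length A → n ≤ length B → dH (take n A) (take n B) ≡ 0 → n ≤ LCP A B
noMismatch zero    _           _           _         _         _  = z≤n
noMismatch (suc n) (true ∷ A)  (true ∷ B)  (s≤s la) (s≤s lb) d  = s≤s (noMismatch n A B la lb d)
noMismatch (suc n) (false ∷ A) (false ∷ B) (s≤s la) (s≤s lb) d  = s≤s (noMismatch n A B la lb d)
noMismatch (suc n) (true ∷ A)  (false ∷ B) _         _         ()
noMismatch (suc n) (false ∷ A) (true ∷ B)  _         _         ()

FirstMismatch : ℕ → Str → Str → Set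
FirstMismatch n A B = ∃[ w ] ∃[ c ] ∃[ A′ ] ∃[ B′ ]
  (A ≡ w ++ c ∷ A′ × B ≡ w ++ not c ∷ B′ × n ≤ length w + suc (LCP A′ B′))

extend : ∀ c {n A B} → n ≤ LCP A B ⊎ FirstMismatch n A B →
  suc n ≤ LCP (c ∷ A) (c ∷ B) ⊎ FirstMismatch (suc n) (c ∷ A) (c ∷ B)
extend c {A = A} {B} (inj₁ agree) = inj₁ (subst (_ ≤_) (sym (LCP-∷ c A B)) (s≤s agree))
extend c (inj₂ (w , d , A′ , B′ , refl , refl , le)) = inj₂ (c ∷ w , d , A′ , B′ , refl , refl , s≤s le)

atMostOneMismatch : ∀ n A B → n ≤ length A → n ≤ length B → dH (take n A) (take n B) ≤ 1 →
  n ≤ LCP A B ⊎ FirstMismatch n A B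
atMostOneMismatch zero    _           _           _         _         _ = inj₁ z≤n
atMostOneMismatch (suc n) (true ∷ A)  (true ∷ B)  (s≤s la) (s≤s lb) d =
  extend true (atMostOneMismatch n A B la lb d)
atMostOneMismatch (suc n) (false ∷ A) (false ∷ B) (s≤s la) (s≤s lb) d =
  extend false (atMostOneMismatch n A B la lb d)
atMostOneMismatch (suc n) (true ∷ A)  (false ∷ B) (s≤s la) (s≤s lb) (s≤s d) =
  inj₂ ([] , true , A , B , refl , refl , s≤s (noMismatch n A B la lb (n≤0⇒n≡0 d)))
atMostOneMismatch (suc n) (false ∷ A) (true ∷ B)  (s≤s la) (s≤s lb) (s≤s d) =
  inj₂ ([] , false , A , B , refl , refl , s≤s (noMismatch n A B la lb (n≤0⇒n≡0 d)))

lcp-distance : ∀ A A′ B B′ → length A ≡ length A′ →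
  dH (take (LCP A′ B′) A) (take (LCP A′ B′) B) ≤ dH A A′ + dH B B′
lcp-distance A A′ B B′ e = begin
  dH (take n A) (take n B)                         ≤⟨ dH-tri (take n A) (take n A′) (take n B) aligned ⟩
  dH (take n A) (take n A′) + dH (take n A′) (take n B) ≡⟨ cong (λ z → dH (take n A) (take n A′) + dH z (take n B)) (LCP-take A′ B′) ⟩
  dH (take n A) (take n A′) + dH (take n B′) (take n B) ≤⟨ +-mono-≤ (dH-take n A A′) (dH-take n B′ B) ⟩
  dH A A′ + dH B′ B                                 ≡⟨ cong (dH A A′ +_) (dH-sym B′ B) ⟩
  dH A A′ + dH B B′                                 ∎
  where
  open ≤-Reasoning
  n = LCP A′ B′
  aligned : length (take n A) ≤ length (take n A′)
  aligned = ≤-reflexive (trans (length-take n A) (trans (cong (n ⊓_) e) (sym (length-take n A′))))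

length-take-≤ : ∀ n (xs : Str) → n ≤ length xs → length (take n xs) ≡ n
length-take-≤ n xs le = trans (length-take n xs) (m≤n⇒m⊓n≡m le)

take-length-++ : ∀ (xs ys : Str) → take (length xs) (xs ++ ys) ≡ xs
take-length-++ []       ys = refl
take-length-++ (x ∷ xs) ys = cong (x ∷_) (take-length-++ xs ys)

take-length+-++ : ∀ (xs ys : Str) n → take (length xs + n) (xs ++ ys) ≡ xs ++ take n ys
take-length+-++ []       ys n = refl
take-length+-++ (x ∷ xs) ys n = cong (x ∷_) (take-length+-++ xs ys n)

drop-length-++ : ∀ (xs ys : Str) → drop (length xs) (xs ++ ys) ≡ ys
drop-length-++ []       ys = refl
drop-length-++ (x ∷ xs) ys = drop-length-++ xs ys

drop-after : ∀ (w : Str) c A → drop (suc (length w)) (w ++ c ∷ A) ≡ A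
drop-after []      c A = refl
drop-after (_ ∷ w) c A = drop-after w c A

-- The cut of U after its first k letters, as in Pairs_ℓ(U) with i = k + 1.
cut : ℕ → Str → StrPair
cut k U = reverse (take k U) , drop k U

window : ℕ → ℕ → StrPair → Str
window a b (P₁ , P₂) = reverse (take a P₁) ++ take b P₂

window-split : ∀ (L₁ L₂ R : Str) b →
  window (length L₂) b (reverse (L₁ ++ L₂) , R) ≡ take (length L₂ + b) (drop (length L₁) ((L₁ ++ L₂) ++ R))
window-split L₁ L₂ R b = begin
  reverse (take (length L₂) (reverse (L₁ ++ L₂))) ++ take b R
    ≡⟨ cong (λ z → reverse (take (length L₂) z) ++ take b R) (reverse-++ L₁ L₂) ⟩
  reverse (take (length L₂) (reverse L₂ ++ reverse L₁)) ++ take b R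
    ≡⟨ cong (λ n → reverse (take n (reverse L₂ ++ reverse L₁)) ++ take b R) (sym (length-reverse L₂)) ⟩
  reverse (take (length (reverse L₂)) (reverse L₂ ++ reverse L₁)) ++ take b R
    ≡⟨ cong (λ z → reverse z ++ take b R) (take-length-++ (reverse L₂) (reverse L₁)) ⟩
  reverse (reverse L₂) ++ take b R
    ≡⟨ cong (_++ take b R) (reverse-involutive L₂) ⟩
  L₂ ++ take b R
    ≡⟨ sym (take-length+-++ L₂ R b) ⟩
  take (length L₂ + b) (L₂ ++ R)
    ≡⟨ cong (take (length L₂ + b)) (sym (drop-length-++ L₁ (L₂ ++ R))) ⟩
  take (length L₂ + b) (drop (length L₁) (L₁ ++ L₂ ++ R))
    ≡⟨ cong (λ z → take (length L₂ + b) (drop (length L₁) z)) (sym (++-assoc L₁ L₂ R)) ⟩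
  take (length L₂ + b) (drop (length L₁) ((L₁ ++ L₂) ++ R)) ∎
  where open ≡-Reasoning

window-last : ∀ (L R : Str) a b → a ≤ length L →
  window a b (reverse L , R) ≡ take (a + b) (drop (length L ∸ a) (L ++ R))
window-last L R a b a≤ =
  at (take k L) (drop k L) (take++drop≡id k L)
     (trans (length-drop k L) (m∸[m∸n]≡n a≤)) (length-take-≤ k L (m∸n≤m (length L) a))
  where
  k = length L ∸ a
  at : ∀ L₁ L₂ {L′ a′ k′} → L₁ ++ L₂ ≡ L′ → length L₂ ≡ a′ → length L₁ ≡ k′ →
    window a′ b (reverse L′ , R) ≡ take (a′ + b) (drop k′ (L′ ++ R))
  at L₁ L₂ refl refl refl = window-split L₁ L₂ R b

window-cut : ∀ k U a b → a ≤ length (take k U) →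
  window a b (cut k U) ≡ take (a + b) (drop (length (take k U) ∸ a) U)
window-cut k U a b a≤ =
  trans (window-last (take k U) (drop k U) a b a≤)
        (cong (λ z → take (a + b) (drop (length (take k U) ∸ a) z)) (take++drop≡id k U))

window-factor : ∀ k U a b → a ≤ length (proj₁ (cut k U)) → b ≤ length (proj₂ (cut k U)) →
  IsFactor (a + b) U (window a b (cut k U))
window-factor k U a b a≤ b≤ = length (take k U) ∸ a , fits , window-cut k U a b a≤take
  where
  a≤take : a ≤ length (take k U)
  a≤take = subst (a ≤_) (length-reverse (take k U)) a≤
  fits : length (take k U) ∸ a + (a + b) ≤ length U
  fits = begin
    length (take k U) ∸ a + (a + b)  ≡⟨ sym (+-assoc (length (take k U) ∸ a) a b) ⟩
    length (take k U) ∸ a + a + b    ≡⟨ cong (_+ b) (m∸n+n≡m a≤take) ⟩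
    length (take k U) + b            ≤⟨ +-monoʳ-≤ (length (take k U)) b≤ ⟩
    length (take k U) + length (drop k U) ≡⟨ sym (length-++ (take k U)) ⟩
    length (take k U ++ drop k U)    ≡⟨ cong length (take++drop≡id k U) ⟩
    length U                         ∎
    where open ≤-Reasoning

window-dH : ∀ a b P Q → a ≤ length (proj₁ P) → a ≤ length (proj₁ Q) →
  dH (window a b P) (window a b Q) ≡
    dH (take a (proj₁ P)) (take a (proj₁ Q)) + dH (take b (proj₂ P)) (take b (proj₂ Q))
window-dH a b (P₁ , P₂) (Q₁ , Q₂) a≤P a≤Q = begin
  dH (reverse (take a P₁) ++ take b P₂) (reverse (take a Q₁) ++ take b Q₂)
    ≡⟨ dH-++ (reverse (take a P₁)) (reverse (take a Q₁)) _ _ reversed-lengths ⟩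
  dH (reverse (take a P₁)) (reverse (take a Q₁)) + dH (take b P₂) (take b Q₂)
    ≡⟨ cong (_+ dH (take b P₂) (take b Q₂)) (dH-reverse (take a P₁) (take a Q₁) lengths) ⟩
  dH (take a P₁) (take a Q₁) + dH (take b P₂) (take b Q₂) ∎
  where
  open ≡-Reasoning
  lengths : length (take a P₁) ≡ length (take a Q₁)
  lengths = trans (length-take-≤ a P₁ a≤P) (sym (length-take-≤ a Q₁ a≤Q))
  reversed-lengths : length (reverse (take a P₁)) ≡ length (reverse (take a Q₁))
  reversed-lengths = trans (length-reverse (take a P₁)) (trans lengths (sym (length-reverse (take a Q₁))))

factor-as-window : ∀ U x h m → h ≤ m → x + m ≤ length U →
  h ≤ length (proj₁ (cut (x + h) U)) × m ∸ h ≤ length (proj₂ (cut (x + h) U)) ×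
  take m (drop x U) ≡ window h (m ∸ h) (cut (x + h) U)
factor-as-window U x h m h≤m x+m≤ = h≤left , rest≤right , occurrence
  where
  k = x + h
  |take| : length (take k U) ≡ k
  |take| = length-take-≤ k U (≤-trans (+-monoʳ-≤ x h≤m) x+m≤)
  h≤take : h ≤ length (take k U)
  h≤take = subst (h ≤_) (sym |take|) (m≤n+m h x)
  h≤left : h ≤ length (reverse (take k U))
  h≤left = subst (h ≤_) (sym (length-reverse (take k U))) h≤take
  rest≤right : m ∸ h ≤ length (drop k U)
  rest≤right = subst₂ _≤_ ([m+n]∸[m+o]≡n∸o x m h) (sym (length-drop k U)) (∸-monoˡ-≤ k x+m≤)
  occurrence : take m (drop x U) ≡ window h (m ∸ h) (cut k U)
  occurrence = begin
    take m (drop x U)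
      ≡⟨ cong₂ (λ n o → take n (drop o U)) (sym (m+[n∸m]≡n h≤m))
                                          (sym (trans (cong (_∸ h) |take|) (m+n∸n≡m x h))) ⟩
    take (h + (m ∸ h)) (drop (length (take k U) ∸ h) U)
      ≡⟨ sym (window-cut k U h (m ∸ h) h≤take) ⟩
    window h (m ∸ h) (cut k U) ∎
    where open ≡-Reasoning

flip-distance : ∀ u c t → dH ((u ++ [ c ]) ++ t) (u ++ not c ∷ drop (suc (length u)) ((u ++ [ c ]) ++ t)) ≡ 1
flip-distance []          true  t = cong suc (dH-refl t)
flip-distance []          false t = cong suc (dH-refl t)
flip-distance (true ∷ u)  c     t = flip-distance u c t
flip-distance (false ∷ u) c     t = flip-distance u c t

flip-length : ∀ u c t → length (u ++ not c ∷ drop (suc (length u)) ((u ++ [ c ]) ++ t)) ≡ length ((u ++ [ c ]) ++ t)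
flip-length []      c t = refl
flip-length (_ ∷ u) c t = cong suc (flip-length u c t)

Nd-close : ∀ {Fam Light} d F G → Nd d Fam Light F G → length G ≡ length F × dH F G ≤ d
Nd-close zero          F _ refl        = refl , ≤-reflexive (dH-refl F)
Nd-close (suc zero)    F _ (inj₁ refl) = refl , ≤-trans (≤-reflexive (dH-refl F)) z≤n
Nd-close (suc zero)    _ _ (inj₂ (u , c , _ , (t , refl) , _ , refl)) =
  flip-length u c t , ≤-reflexive (flip-distance u c t)
Nd-close (suc (suc d)) _ _ ()

pairValue-LCF : ∀ {S Fam Light X Y k₁ k₂ P′ Q′} →
  PairsD k₁ S Fam Light X P′ → PairsD k₂ S Fam Light Y Q′ →
  LCFSet (k₁ + k₂) X Y (LCP (proj₁ P′) (proj₁ Q′) + LCP (proj₂ P′) (proj₂ Q′))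
pairValue-LCF {X = X} {Y} {P′ = P′₁ , P′₂} {Q′₁ , Q′₂}
  (_ , d₁ , d₂ , (i , _ , _ , _ , refl) , _ , _ , refl , n₁ , n₂)
  (_ , e₁ , e₂ , (j , _ , _ , _ , refl) , _ , _ , refl , o₁ , o₂) =
  window a b P , window a b Q ,
  window-factor (i ∸ 1) X a b a≤P₁ b≤P₂ , window-factor (j ∸ 1) Y a b a≤Q₁ b≤Q₂ , distance
  where
  P = cut (i ∸ 1) X
  Q = cut (j ∸ 1) Y
  a = LCP P′₁ Q′₁
  b = LCP P′₂ Q′₂
  closeP₁ = Nd-close d₁ (proj₁ P) P′₁ n₁
  closeP₂ = Nd-close d₂ (proj₂ P) P′₂ n₂
  closeQ₁ = Nd-close e₁ (proj₁ Q) Q′₁ o₁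
  closeQ₂ = Nd-close e₂ (proj₂ Q) Q′₂ o₂
  a≤P₁ = subst (a ≤_) (proj₁ closeP₁) (LCP-lenˡ P′₁ Q′₁)
  b≤P₂ = subst (b ≤_) (proj₁ closeP₂) (LCP-lenˡ P′₂ Q′₂)
  a≤Q₁ = subst (a ≤_) (proj₁ closeQ₁) (LCP-lenʳ P′₁ Q′₁)
  b≤Q₂ = subst (b ≤_) (proj₁ closeQ₂) (LCP-lenʳ P′₂ Q′₂)
  distance : dH (window a b P) (window a b Q) ≤ (d₁ + d₂) + (e₁ + e₂)
  distance = begin
    dH (window a b P) (window a b Q)
      ≡⟨ window-dH a b P Q a≤P₁ a≤Q₁ ⟩
    dH (take a (proj₁ P)) (take a (proj₁ Q)) + dH (take b (proj₂ P)) (take b (proj₂ Q))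
      ≤⟨ +-mono-≤ (lcp-distance _ P′₁ _ Q′₁ (sym (proj₁ closeP₁)))
                  (lcp-distance _ P′₂ _ Q′₂ (sym (proj₁ closeP₂))) ⟩
    (dH (proj₁ P) P′₁ + dH (proj₁ Q) Q′₁) + (dH (proj₂ P) P′₂ + dH (proj₂ Q) Q′₂)
      ≤⟨ +-mono-≤ (+-mono-≤ (proj₂ closeP₁) (proj₂ closeQ₁)) (+-mono-≤ (proj₂ closeP₂) (proj₂ closeQ₂)) ⟩
    (d₁ + e₁) + (d₂ + e₂)
      ≡⟨ interchange d₁ e₁ d₂ e₂ ⟩
    (d₁ + d₂) + (e₁ + e₂) ∎
    where open ≤-Reasoning

sound : ∀ {S Fam Light X Y m k₁ k₂ n} → IsLCF 1 X Y m → k₁ + k₂ ≡ 1 →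
  PairLCPVal (PairsD k₁ S Fam Light X) (PairsD k₂ S Fam Light Y) n → n ≤ m
sound {S} {Fam} {Light} {X} {Y} lcf total ((P′₁ , P′₂) , (Q′₁ , Q′₂) , p , q , refl) =
  proj₂ lcf _ (subst (λ k → LCFSet k X Y (LCP P′₁ Q′₁ + LCP P′₂ Q′₂)) total (pairValue-LCF {S} {Fam} {Light} p q))

attains : ∀ {S Fam Light X Y m k₁ k₂ v} → IsLCF 1 X Y m → k₁ + k₂ ≡ 1 → m ≤ v →
  PairLCPVal (PairsD k₁ S Fam Light X) (PairsD k₂ S Fam Light Y) v →
  IsMaxPairLCP (PairsD k₁ S Fam Light X) (PairsD k₂ S Fam Light Y) m
attains lcf total m≤v value =
  subst (PairLCPVal _ _) (≤-antisym (sound lcf total value) m≤v) value ,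
  λ _ → sound lcf total

child : ∀ {Fam : Str → Set} w c A → Fam (w ++ c ∷ A) → HasChild Fam w c
child w c A fam = w ++ c ∷ A , fam , A , ++-assoc w [ c ] A

branching-light : ∀ {Fam Light} → ValidLight Fam Light → ∀ w c A B →
  Fam (w ++ c ∷ A) → Fam (w ++ not c ∷ B) → IsNode Fam w × (Light w c ⊎ Light w (not c))
branching-light valid w false A B fA fB =
  let node = inj₂ (inj₁ (child w false A fA , child w true B fB))
  in node , valid w node (child w false A fA) (child w true B fB)
branching-light valid w true A B fA fB =
  let node = inj₂ (inj₁ (child w false B fB , child w true A fA))
  in node , swap (valid w node (child w false B fB) (child w true A fA))

flip-N1 : ∀ {Fam Light w c} A → IsNode Fam w → Light w c →
  N1 Fam Light (w ++ c ∷ A) (w ++ not c ∷ A)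
flip-N1 {w = w} {c} A node light =
  inj₂ (w , c , node , (A , ++-assoc w [ c ] A) , light , cong (λ t → w ++ not c ∷ t) (sym (drop-after w c A)))

Reach : (Str → Set) → (Str → Bool → Set) → ℕ → ℕ → Str → Str → ℕ → Set
Reach Fam Light d e A B n = ∃[ A′ ] ∃[ B′ ]
  (Nd d Fam Light A A′ × Nd e Fam Light B B′ × n ≤ LCP A′ B′)

-- Family strings whose n-prefixes differ in at most one letter can be made to agree on
-- n letters with one unit of budget, spent on one side (by a flip) or wasted.
repair : ∀ {Fam Light} → ValidLight Fam Light → ∀ n A B → Fam A → Fam B →
  n ≤ length A → n ≤ length B → dH (take n A) (take n B) ≤ 1 →
  ∃[ d ] ∃[ e ] (d + e ≡ 1 × Reach Fam Light d e A B n)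
repair {Fam} {Light} valid n A B fA fB la lb close with atMostOneMismatch n A B la lb close
... | inj₁ agree = 1 , 0 , refl , A , B , inj₁ refl , refl , agree
... | inj₂ (w , c , A′ , B′ , refl , refl , n≤) with branching-light {Fam} {Light} valid w c A′ B′ fA fB
...   | node , inj₁ light = 1 , 0 , refl , _ , _ , flip-N1 {Fam} {Light} A′ node light , refl ,
          subst (n ≤_) (sym (LCP-after w (not c) A′ B′)) n≤
...   | node , inj₂ light = 0 , 1 , refl , _ , _ , refl ,
          subst (λ c′ → N1 Fam Light (w ++ not c ∷ B′) (w ++ c′ ∷ B′)) (not-involutive c) (flip-N1 {Fam} {Light} B′ node light) ,
          subst (n ≤_) (sym (LCP-after w c A′ B′)) n≤

SplitValue : Str → Str → (ℕ → Set) → (Str → Bool → Set) → ℕ → Set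
SplitValue X Y S Light n = ∃[ k₁ ] ∃[ k₂ ] (k₁ ≤ 1 × k₂ ≤ 1 × k₁ + k₂ ≡ 1 ×
  IsMaxPairLCP (PairsD k₁ S (InFam S X Y) Light X) (PairsD k₂ S (InFam S X Y) Light Y) n)

realise : ∀ {X Y S Light m P Q d₁ e₁ d₂ e₂ a b} → IsLCF 1 X Y m →
  Pairs S X P → Pairs S Y Q →
  Reach (InFam S X Y) Light d₁ e₁ (proj₁ P) (proj₁ Q) a →
  Reach (InFam S X Y) Light d₂ e₂ (proj₂ P) (proj₂ Q) b →
  (d₁ + e₁) + (d₂ + e₂) ≡ 1 → m ≤ a + b → SplitValue X Y S Light m
realise {d₁ = d₁} {e₁} {d₂} {e₂} lcf pX pY (P′₁ , Q′₁ , n₁ , o₁ , a≤) (P′₂ , Q′₂ , n₂ , o₂ , b≤) total m≤ =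
  d₁ + d₂ , e₁ + e₂ , k₁≤1 , k₂≤1 , budget ,
  attains lcf budget (≤-trans m≤ (+-mono-≤ a≤ b≤)) value
  where
  budget : (d₁ + d₂) + (e₁ + e₂) ≡ 1
  budget = trans (interchange d₁ d₂ e₁ e₂) total
  k₁≤1 = proj₁ (parts≤ (d₁ + d₂) (e₁ + e₂) (≤-reflexive budget))
  k₂≤1 = proj₂ (parts≤ (d₁ + d₂) (e₁ + e₂) (≤-reflexive budget))
  value = (P′₁ , P′₂) , (Q′₁ , Q′₂) ,
          (_ , d₁ , d₂ , pX , proj₁ (parts≤ d₁ d₂ k₁≤1) , proj₂ (parts≤ d₁ d₂ k₁≤1) , refl , n₁ , n₂) ,
          (_ , e₁ , e₂ , pY , proj₁ (parts≤ e₁ e₂ k₂≤1) , proj₂ (parts≤ e₁ e₂ k₂≤1) , refl , o₁ , o₂) ,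
          refl

complete : ∀ {X Y S Light m} → ValidLight (InFam S X Y) Light → IsLCF 1 X Y m →
  ∀ x y h → x + m ≤ length X → y + m ≤ length Y →
  dH (take m (drop x X)) (take m (drop y Y)) ≤ 1 → h < m →
  S (suc (x + h)) → S (suc (y + h)) → SplitValue X Y S Light m
complete {X} {Y} {S} {Light} {m} valid lcf x y h x+m≤ y+m≤ close h<m sX sY =
  from-halves (split-≤1 _ _ halves)
  where
  b = m ∸ h
  P = cut (x + h) X
  Q = cut (y + h) Y
  windowX = factor-as-window X x h m (<⇒≤ h<m) x+m≤
  windowY = factor-as-window Y y h m (<⇒≤ h<m) y+m≤
  h≤P₁ = proj₁ windowX
  b≤P₂ = proj₁ (proj₂ windowX)
  h≤Q₁ = proj₁ windowY
  b≤Q₂ = proj₁ (proj₂ windowY)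
  pairX : Pairs S X P
  pairX = suc (x + h) , sX , s≤s z≤n , ≤-trans (+-monoʳ-< x h<m) x+m≤ , refl
  pairY : Pairs S Y Q
  pairY = suc (y + h) , sY , s≤s z≤n , ≤-trans (+-monoʳ-< y h<m) y+m≤ , refl
  m≤h+b : m ≤ h + b
  m≤h+b = ≤-reflexive (sym (m+[n∸m]≡n (<⇒≤ h<m)))
  halves : dH (take h (proj₁ P)) (take h (proj₁ Q)) + dH (take b (proj₂ P)) (take b (proj₂ Q)) ≤ 1
  halves = subst (_≤ 1) (trans (cong₂ dH (proj₂ (proj₂ windowX)) (proj₂ (proj₂ windowY)))
                               (window-dH h b P Q h≤P₁ h≤Q₁)) close
  from-halves : (dH (take h (proj₁ P)) (take h (proj₁ Q)) ≡ 0 × dH (take b (proj₂ P)) (take b (proj₂ Q)) ≤ 1)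
              ⊎ (dH (take h (proj₁ P)) (take h (proj₁ Q)) ≤ 1 × dH (take b (proj₂ P)) (take b (proj₂ Q)) ≡ 0)
              → SplitValue X Y S Light m
  from-halves (inj₁ (left≡0 , right≤1)) =
    let (d , e , d+e≡1 , right) = repair valid b _ _ (P , inj₁ pairX , inj₂ refl) (Q , inj₂ pairY , inj₂ refl)
                                         b≤P₂ b≤Q₂ right≤1
        left = _ , _ , refl , refl , noMismatch h _ _ h≤P₁ h≤Q₁ left≡0
    in realise lcf pairX pairY left right d+e≡1 m≤h+b
  from-halves (inj₂ (left≤1 , right≡0)) =
    let (d , e , d+e≡1 , left) = repair valid h _ _ (P , inj₁ pairX , inj₁ refl) (Q , inj₂ pairY , inj₁ refl)
                                        h≤P₁ h≤Q₁ left≤1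
        right = _ , _ , refl , refl , noMismatch b _ _ b≤P₂ b≤Q₂ right≡0
    in realise lcf pairX pairY left right (trans (+-identityʳ (d + e)) d+e≡1) m≤h+b

corollary7 : (X Y : Str) (ℓ : ℕ) → 1 ≤ ℓ →
    (S : ℕ → Set) → IsCover ℓ S →
    (Light : Str → Bool → Set) → ValidLight (InFam S X Y) Light →
    (m : ℕ) → IsLCF 1 X Y m → ℓ ≤ m →
    IsMax (λ n → ∃[ k₁ ] ∃[ k₂ ] (k₁ ≤ 1 × k₂ ≤ 1 × k₁ + k₂ ≡ 1 ×
      IsMaxPairLCP (PairsD k₁ S (InFam S X Y) Light X)
                   (PairsD k₂ S (InFam S X Y) Light Y) n)) m
corollary7 X Y ℓ _ S (_ , shift , covers) Light valid m lcf ℓ≤m = attained (proj₁ lcf) , bounded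
  where
  bounded : ∀ n → SplitValue X Y S Light n → n ≤ m
  bounded n (_ , _ , _ , _ , total , isMax) = sound lcf total (proj₁ isMax)
  attained : LCFSet 1 X Y m → SplitValue X Y S Light m
  attained (_ , _ , (x , x+m≤ , refl) , (y , y+m≤ , refl) , close) =
    let (h<ℓ , sX , sY) = covers (suc x) (suc y) (s≤s z≤n) (s≤s z≤n)
    in complete valid lcf x y (shift (suc x) (suc y)) x+m≤ y+m≤ close (≤-trans h<ℓ ℓ≤m) sX sY
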